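{- The graphs $C$, $B^+$, $B$, $A^+$, $A$ and $K_{3,3}$ have no $K_{2,4}$ minor.
   Context: $C^+$ is the graph with vertex set $\{v_1,\ldots,v_8\}$ and edges $v_1v_2, v_1v_3, v_2v_3, v_1v_7, v_2v_8, v_3v_6, v_4v_5$, and $v_iv_j$ for all $i \in \{4,5\}$, $j \in \{6,7,8\}$; $C = C^+ \backslash v_4v_5$. $B^+$ is the graph with vertex set $\{w,v_2,v_3,v_4,v_5,v_6,v_8\}$ and edges $wv_2, wv_3, v_2v_3, wv_4, wv_5, v_4v_5, v_4v_6, v_4v_8, v_5v_6, v_5v_8, v_3v_6, v_2v_8$ (it is $C^+$ with the edge $v_1v_7$ contracted to $w$); $B = B^+ \backslash v_4v_5$. $A$ is $K_{3,3}$ with one added edge joining two vertices in the same part of the bipartition, and $A^+$ is $K_{3,3}$ with one added edge inside each of the two parts. Minors are taken in the usual sense for simple graphs. -}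

module Defs where

open import Data.Nat using (ℕ)
open import Data.Fin using (Fin)
open import Data.Fin.Patterns
open import Data.List using (List; []; _∷_)
open import Data.List.Relation.Unary.Any using (Any)
open import Data.Maybe using (Maybe; just)
open import Data.Product using (_×_; _,_; ∃; ∃-syntax)
open import Data.Sum using (_⊎_)
open import Relation.Binary.PropositionalEquality using (_≡_)

-- Adjacency is the symmetric closure of the edge list (all lists below
-- contain no loops and no repeated edges, so these are simple graphs).
record Graph : Set where
  constructor graph
  field
    size  : ℕ
    edges : List (Fin size × Fin size)

open Graph public

Adj : (G : Graph) → Fin (size G) → Fin (size G) → Set
Adj G u v = Any (λ e → (e ≡ (u , v)) ⊎ (e ≡ (v , u))) (edges G)

data PathIn (G : Graph) (P : Fin (size G) → Set) : Fin (size G) → Fin (size G) → Set where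
  here  : ∀ {u} → P u → PathIn G P u u
  there : ∀ {u w v} → P u → Adj G u w → PathIn G P w v → PathIn G P u v

-- The map β sends each vertex of G to the (unique, if any)
-- vertex of H whose branch set contains it, which makes disjointness automatic.
record MinorModel (H G : Graph) : Set where
  field
    β         : Fin (size G) → Maybe (Fin (size H))
    nonempty  : ∀ h → ∃[ v ] (β v ≡ just h)
    connected : ∀ h u v → β u ≡ just h → β v ≡ just h →
                PathIn G (λ x → β x ≡ just h) u v
    edgeCover : ∀ h k → Adj H h k →
                ∃[ u ] ∃[ v ] (β u ≡ just h × β v ≡ just k × Adj G u v)

_≼_ : Graph → Graph → Set
H ≼ G = MinorModel H G

K24 : Graph
K24 = graph 6
  ( (0F , 2F) ∷ (0F , 3F) ∷ (0F , 4F) ∷ (0F , 5F)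
  ∷ (1F , 2F) ∷ (1F , 3F) ∷ (1F , 4F) ∷ (1F , 5F) ∷ [])

K33 : Graph
K33 = graph 6
  ( (0F , 3F) ∷ (0F , 4F) ∷ (0F , 5F)
  ∷ (1F , 3F) ∷ (1F , 4F) ∷ (1F , 5F)
  ∷ (2F , 3F) ∷ (2F , 4F) ∷ (2F , 5F) ∷ [])

A : Graph
A = graph 6 ((0F , 1F) ∷ edges K33)

A⁺ : Graph
A⁺ = graph 6 ((0F , 1F) ∷ (3F , 4F) ∷ edges K33)

-- C: vertices v1..v8 encoded as 0..7 (v_i ↦ i-1).
-- Edges v1v2, v1v3, v2v3, v1v7, v2v8, v3v6, v_iv_j (i∈{4,5}, j∈{6,7,8}).
C : Graph
C = graph 8
  ( (0F , 1F) ∷ (0F , 2F) ∷ (1F , 2F) ∷ (0F , 6F) ∷ (1F , 7F) ∷ (2F , 5F)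
  ∷ (3F , 5F) ∷ (3F , 6F) ∷ (3F , 7F)
  ∷ (4F , 5F) ∷ (4F , 6F) ∷ (4F , 7F) ∷ [])

-- B⁺: vertices w,v2,v3,v4,v5,v6,v8 encoded as 0,1,2,3,4,5,6.
-- Edges wv2, wv3, v2v3, wv4, wv5, v4v5, v4v6, v4v8, v5v6, v5v8, v3v6, v2v8.
B⁺ : Graph
B⁺ = graph 7
  ( (0F , 1F) ∷ (0F , 2F) ∷ (1F , 2F) ∷ (0F , 3F) ∷ (0F , 4F) ∷ (3F , 4F)
  ∷ (3F , 5F) ∷ (3F , 6F) ∷ (4F , 5F) ∷ (4F , 6F) ∷ (2F , 5F) ∷ (1F , 6F) ∷ [])

-- B = B⁺ minus v4v5.
B : Graph
B = graph 7
  ( (0F , 1F) ∷ (0F , 2F) ∷ (1F , 2F) ∷ (0F , 3F) ∷ (0F , 4F)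
  ∷ (3F , 5F) ∷ (3F , 6F) ∷ (4F , 5F) ∷ (4F , 6F) ∷ (2F , 5F) ∷ (1F , 6F) ∷ [])

-- A K₂,₄ minor model of G is a map β from the vertices of G to those of K₂,₄ or to
-- "unused". Such maps are enumerated vertex by vertex, and a partial assignment is
-- abandoned as soon as some branch set can no longer be nonempty, some edge of K₂,₄ can no
-- longer be realised by an edge of G, or some vertex committed to a branch set that has
-- another committed vertex has no neighbour that could still lie in it. Transposing two
-- vertices on the same side of K₂,₄ is an automorphism, so a label is only tried at a
-- vertex if no smaller interchangeable label is still unused. For each of the six graphs
-- every branch of this search dies.
module Submission where

open import Defs
open import Data.Bool using (Bool; true; false; T; not; _∧_; _∨_)
import Data.Bool as Bool
open import Data.Bool.ListAction using (all; any)
open import Data.Bool.Properties using (T?; T-∧; T-∨; T-≡)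
open import Data.Empty using (⊥-elim)
open import Data.Fin using (Fin; toℕ; _≟_; _<_)
open import Data.Fin.Induction using (<-wellFounded)
open import Data.Fin.Permutation using (Permutation′; _⟨$⟩ʳ_; _⟨$⟩ˡ_; inverseˡ; inverseʳ; transpose)
import Data.Fin.Permutation.Components as PC
open import Data.Fin.Properties using (_<?_; all?)
open import Data.List using (List; []; _∷_; allFin)
open import Data.List.Membership.Propositional.Properties using (∈-allFin)
open import Data.List.Relation.Unary.All using (tabulate; lookup)
open import Data.List.Relation.Unary.All.Properties using (all⁺; all⁻)
import Data.List.Relation.Unary.Any as Any
open import Data.List.Relation.Unary.Any using (any?)
open import Data.List.Relation.Unary.Any.Properties using (any⁺; any⁻)
open import Data.Maybe using (Maybe; just; nothing)
import Data.Maybe as Maybe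
open import Data.Maybe.Relation.Unary.All using (just; nothing) renaming (All to MaybeAll)
import Data.Nat as ℕ
open import Data.Product using (_×_; _,_; ∃-syntax)
open import Data.Product.Properties using (≡-dec)
open import Data.Sum using (_⊎_; inj₁; inj₂)
open import Data.Unit using (tt)
open import Data.Vec.Functional using (updateAt)
open import Data.Vec.Functional.Properties using (updateAt-updates; updateAt-minimal)
open import Function using (_∘_; const)
open import Function.Bundles using (Equivalence)
open import Induction.WellFounded using (Acc; acc)
open import Relation.Binary.PropositionalEquality using (_≡_; _≢_; refl; sym; cong; subst; module ≡-Reasoning)
open import Relation.Nullary using (¬_; Dec; yes; no)
open import Relation.Nullary.Decidable using (_⊎-dec_; _→-dec_; dec-true; dec-false; ⌊_⌋; toWitness; toWitnessFalse; fromWitness)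

open Equivalence using (to; from)

private
  variable
    m n : ℕ.ℕ

Adj? : (G : Graph) → ∀ u v → Dec (Adj G u v)
Adj? G u v = any? (λ e → ≡-dec _≟_ _≟_ e (u , v) ⊎-dec ≡-dec _≟_ _≟_ e (v , u)) (edges G)

PreservesAdj : (H : Graph) → (Fin (size H) → Fin (size H)) → Set
PreservesAdj H σ = ∀ {h k} → Adj H h k → Adj H (σ h) (σ k)

module _ {G : Graph} where

  PathIn-map : ∀ {P Q : Fin (size G) → Set} → (∀ {x} → P x → Q x) →
               ∀ {u v} → PathIn G P u v → PathIn G Q u v
  PathIn-map f (here pu)        = here (f pu)
  PathIn-map f (there pu uw wv) = there (f pu) uw (PathIn-map f wv)

  PathIn-head : ∀ {P u v} → PathIn G P u v → P u
  PathIn-head (here pu)      = pu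
  PathIn-head (there pu _ _) = pu

  PathIn-neighbour : ∀ {P u v} → PathIn G P u v → u ≢ v → ∃[ w ] (Adj G u w × P w)
  PathIn-neighbour (here _)          u≢u = ⊥-elim (u≢u refl)
  PathIn-neighbour (there _ uw rest) _   = _ , uw , PathIn-head rest

relabel : ∀ {H G} (π : Permutation′ (size H)) → PreservesAdj H (π ⟨$⟩ˡ_) → H ≼ G → H ≼ G
relabel {H} {G} π π⁻¹-aut M = record
  { β         = β′
  ; nonempty  = λ h → let v , βv = nonempty (π ⟨$⟩ˡ h) in v , relabelled βv
  ; connected = λ h u v β′u β′v →
      PathIn-map relabelled (connected (π ⟨$⟩ˡ h) u v (unrelabelled β′u) (unrelabelled β′v))
  ; edgeCover = λ h k hk →
      let u , v , βu , βv , uv = edgeCover _ _ (π⁻¹-aut hk)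
      in u , v , relabelled βu , relabelled βv , uv
  }
  where
  open MinorModel M

  β′ : Fin (size G) → Maybe (Fin (size H))
  β′ x = Maybe.map (π ⟨$⟩ʳ_) (β x)

  relabelled : ∀ {x h} → β x ≡ just (π ⟨$⟩ˡ h) → β′ x ≡ just h
  relabelled {x} βx rewrite βx = cong just (inverseʳ π)

  unrelabelled : ∀ {x h} → β′ x ≡ just h → β x ≡ just (π ⟨$⟩ˡ h)
  unrelabelled {x} β′x with β x
  unrelabelled refl | just c = cong just (sym (inverseˡ π))

transpose-first : (i j : Fin n) → PC.transpose i j i ≡ j
transpose-first i j rewrite dec-true (i ≟ i) refl = refl

transpose-fixes : {i j k : Fin n} → k ≢ i → k ≢ j → PC.transpose i j k ≡ k
transpose-fixes {i = i} {j} {k} k≢i k≢j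
  rewrite dec-false (k ≟ i) k≢i | dec-false (k ≟ j) k≢j = refl

all-allFin⁺ : {f : Fin n → Bool} → (∀ i → T (f i)) → T (all f (allFin n))
all-allFin⁺ {n = n} {f = f} fT = all⁻ f (tabulate {xs = allFin n} λ {i} _ → fT i)

all-allFin⁻ : {f : Fin n → Bool} → T (all f (allFin n)) → ∀ i → T (f i)
all-allFin⁻ {n = n} {f = f} fT i = lookup (all⁺ f (allFin n) fT) (∈-allFin i)

any-allFin⁺ : {f : Fin n → Bool} (i : Fin n) → T (f i) → T (any f (allFin n))
any-allFin⁺ {f = f} i fi = any⁺ f (Any.map (λ { refl → fi }) (∈-allFin i))

-- A partial guess at the branch-set map β of a minor model: `nothing` leaves a vertex
-- undecided, `just b` commits to β taking the value b there.
Partial : ℕ.ℕ → ℕ.ℕ → Set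
Partial n m = Fin n → Maybe (Maybe (Fin m))

Extends : (Fin n → Maybe (Fin m)) → Partial n m → Set
Extends β p = ∀ i → MaybeAll (_≡ β i) (p i)

assign : Partial n m → Fin n → Maybe (Fin m) → Partial n m
assign p i b = updateAt p i (const (just b))

module _ {β : Fin n → Maybe (Fin m)} {p : Partial n m} {i : Fin n} {b : Maybe (Fin m)} where

  assign-extends : (∀ j → j ≢ i → MaybeAll (_≡ β j) (p j)) → b ≡ β i → Extends β (assign p i b)
  assign-extends rest bi j with j ≟ i
  ... | yes refl rewrite updateAt-updates i {const (just b)} p = just bi
  ... | no j≢i   rewrite updateAt-minimal j i {const (just b)} p j≢i = rest j j≢i

  extends-assigned : Extends β (assign p i b) → b ≡ β i
  extends-assigned ext with ext i
  ... | e rewrite updateAt-updates i {const (just b)} p with e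
  ...   | just bi = bi

  extends-unassigned : Extends β (assign p i b) → ∀ j → j ≢ i → MaybeAll (_≡ β j) (p j)
  extends-unassigned ext j j≢i = subst (MaybeAll (_≡ β j)) (updateAt-minimal j i p j≢i) (ext j)

possibly : Fin m → Maybe (Maybe (Fin m)) → Bool
possibly h nothing         = true
possibly h (just nothing)  = false
possibly h (just (just k)) = ⌊ k ≟ h ⌋

surely : Fin m → Maybe (Maybe (Fin m)) → Bool
surely h (just (just k)) = ⌊ k ≟ h ⌋
surely h _               = false

module _ {h : Fin m} {b : Maybe (Fin m)} where

  possibly-sound : {c : Maybe (Maybe (Fin m))} → MaybeAll (_≡ b) c → b ≡ just h → T (possibly h c)
  possibly-sound nothing     _    = tt
  possibly-sound (just refl) refl = fromWitness refl

  surely-sound : {c : Maybe (Maybe (Fin m))} → MaybeAll (_≡ b) c → T (surely h c) → b ≡ just h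
  surely-sound {just (just k)} (just refl) kh = cong just (toWitness kh)

module MinorSearch (H G : Graph) where

  private
    Vertex = Fin (size G)
    Guess  = Partial (size G) (size H)

  edgeBetween : (Vertex → Bool) → (Vertex → Bool) → Bool
  edgeBetween P Q = any (λ (a , b) → P a ∧ Q b ∨ Q a ∧ P b) (edges G)

  edgeBetween-sound : ∀ {P Q u v} → Adj G u v → T (P u) → T (Q v) → T (edgeBetween P Q)
  edgeBetween-sound {P} {Q} uv Pu Qv = any⁺ _ (Any.map edge uv)
    where
    edge : ∀ {e} → (e ≡ _ ⊎ e ≡ _) → T ((λ (a , b) → P a ∧ Q b ∨ Q a ∧ P b) e)
    edge (inj₁ refl) = from T-∨ (inj₁ (from T-∧ (Pu , Qv)))
    edge (inj₂ refl) = from T-∨ (inj₂ (from T-∧ (Qv , Pu)))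

  branchSetsNonempty : Guess → Bool
  branchSetsNonempty p = all (λ h → any (λ v → possibly h (p v)) (allFin (size G))) (allFin (size H))

  edgesCovered : Guess → Bool
  edgesCovered p = all (λ (h , k) → edgeBetween (possibly h ∘ p) (possibly k ∘ p)) (edges H)

  branchSetsConnected : Guess → Bool
  branchSetsConnected p = all (λ u → all (λ h → not (surely h (p u))
      ∨ edgeBetween (λ a → ⌊ a ≟ u ⌋) (possibly h ∘ p)
      ∨ all (λ v → ⌊ v ≟ u ⌋ ∨ not (surely h (p v))) (allFin (size G))) (allFin (size H))) (allFin (size G))

  feasible : Guess → Bool
  feasible p = branchSetsNonempty p ∧ edgesCovered p ∧ branchSetsConnected p

  module _ (M : H ≼ G) {p : Guess} (ext : Extends (MinorModel.β M) p) where
    open MinorModel M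

    branchSetsNonempty-sound : T (branchSetsNonempty p)
    branchSetsNonempty-sound = all-allFin⁺ λ h →
      let v , βv = nonempty h in any-allFin⁺ v (possibly-sound (ext v) βv)

    edgesCovered-sound : T (edgesCovered p)
    edgesCovered-sound = all⁻ _ (tabulate covered)
      where
      covered : ∀ {e} → Any.Any (e ≡_) (edges H) → T ((λ (h , k) → edgeBetween (possibly h ∘ p) (possibly k ∘ p)) e)
      covered {h , k} hk =
        let u , v , βu , βv , uv = edgeCover h k (Any.map (inj₁ ∘ sym) hk)
        in edgeBetween-sound {possibly h ∘ p} {possibly k ∘ p} uv (possibly-sound (ext u) βu) (possibly-sound (ext v) βv)

    branchSetsConnected-sound : T (branchSetsConnected p)
    branchSetsConnected-sound = all-allFin⁺ λ u → all-allFin⁺ λ h → connectedAt u h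
      where
      connectedAt : ∀ u h → T (not (surely h (p u))
          ∨ edgeBetween (λ a → ⌊ a ≟ u ⌋) (possibly h ∘ p)
          ∨ all (λ v → ⌊ v ≟ u ⌋ ∨ not (surely h (p v))) (allFin (size G)))
      connectedAt u h with surely h (p u) in su | T? (edgeBetween (λ a → ⌊ a ≟ u ⌋) (possibly h ∘ p))
      ... | false | _        = tt
      ... | true  | yes nbr  = from T-∨ (inj₁ nbr)
      ... | true  | no ¬nbr  = from T-∨ (inj₂ (all-allFin⁺ sole))
        where
        βu = surely-sound (ext u) (from T-≡ su)
        sole : ∀ v → T (⌊ v ≟ u ⌋ ∨ not (surely h (p v)))
        sole v with v ≟ u
        ... | yes _   = tt
        ... | no v≢u with surely h (p v) in sv
        ...   | false = tt
        ...   | true  =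
          let w , uw , βw = PathIn-neighbour (connected h u v βu (surely-sound (ext v) (from T-≡ sv))) (v≢u ∘ sym)
          in ¬nbr (edgeBetween-sound {λ a → ⌊ a ≟ u ⌋} {possibly h ∘ p} uw (fromWitness refl) (possibly-sound (ext w) βw))

    feasible-sound : T (feasible p)
    feasible-sound = from T-∧ (branchSetsNonempty-sound , from T-∧ (edgesCovered-sound , branchSetsConnected-sound))

  unused : Guess → Fin (size H) → Bool
  unused p a = all (λ j → not (surely a (p j))) (allFin (size G))

  unused⁻ : ∀ {p a} → T (unused p a) → ∀ {j k} → p j ≡ just (just k) → k ≢ a
  unused⁻ {p} {a} ua {j} {k} pj = toWitnessFalse {a? = k ≟ a}
    (subst (T ∘ not ∘ surely a) pj (all-allFin⁻ {f = λ j → not (surely a (p j))} ua j))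

  module Symmetric (swappable : Fin (size H) → Fin (size H) → Bool)
                   (swappable⇒preservesAdj : ∀ {a b} → T (swappable a b) → PreservesAdj H (PC.transpose a b))
                   where

    -- The label y need not be tried at a vertex if a smaller, swappable label is, and
    -- neither of them is used yet: the transposition turns one model into the other.
    redundant : Guess → Fin (size H) → Bool
    redundant p y = unused p y ∧ any (λ x → ⌊ x <? y ⌋ ∧ swappable x y ∧ unused p x) (allFin (size H))

    redundant⁻ : ∀ {p y} → T (redundant p y) →
                 ∃[ x ] (x < y × T (swappable x y) × T (unused p x) × T (unused p y))
    redundant⁻ {p} {y} red =
      let uy , smaller = to T-∧ red
          x , x<y∧xy∧ux = Any.satisfied (any⁻ _ (allFin (size H)) smaller)
          x<y , xy∧ux = to T-∧ x<y∧xy∧ux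
          xy , ux = to T-∧ xy∧ux
      in x , toWitness {a? = x <? y} x<y , xy , ux , uy

    refutes : List Vertex → Guess → Bool
    refutes []       p = not (feasible p)
    refutes (i ∷ is) p = not (feasible p) ∨
      (refutes is (assign p i nothing) ∧ all (λ y → redundant p y ∨ refutes is (assign p i (just y))) (allFin (size H)))

    module _ {x y : Fin (size H)} (xy : T (swappable x y)) (M : H ≼ G) where
      open MinorModel M using (β)
      open ≡-Reasoning

      swapped : H ≼ G
      swapped = relabel (transpose y x) (swappable⇒preservesAdj xy) M

      swapped-agrees : ∀ {p} → T (unused p x) → T (unused p y) →
                       ∀ j → MaybeAll (_≡ β j) (p j) → MaybeAll (_≡ MinorModel.β swapped j) (p j)
      swapped-agrees {p} ux uy j βj with p j in pj | βj
      ... | nothing       | nothing = nothing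
      ... | just nothing  | just e  = just (cong (Maybe.map _) e)
      ... | just (just k) | just e  = just (begin
        just k                         ≡⟨ cong just (transpose-fixes (unused⁻ {p} uy pj) (unused⁻ {p} ux pj)) ⟨
        just (PC.transpose y x k)      ≡⟨ cong (Maybe.map _) e ⟩
        Maybe.map (PC.transpose y x) (β j) ∎)

      swapped-extends : ∀ {p i} → T (unused p x) → T (unused p y) →
                        Extends β (assign p i (just y)) → Extends (MinorModel.β swapped) (assign p i (just x))
      swapped-extends {p} {i} ux uy ext =
        assign-extends (λ j j≢i → swapped-agrees {p} ux uy j (extends-unassigned ext j j≢i)) (begin
          just x                         ≡⟨ cong just (transpose-first y x) ⟨
          just (PC.transpose y x y)      ≡⟨ cong (Maybe.map _) (extends-assigned ext) ⟩
          Maybe.map (PC.transpose y x) (β i) ∎)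

    refutes-sound : ∀ is {p} (M : H ≼ G) → Extends (MinorModel.β M) p → ¬ T (refutes is p)
    refutes-sound [] {p} M ext r with feasible p | feasible-sound M ext
    ... | true | _ = r
    refutes-sound (i ∷ is) {p} M ext r with feasible p | feasible-sound M ext
    ... | true | _ with to T-∧ r | MinorModel.β M i in βi
    ...   | unassigned , _ | nothing = refutes-sound is M (assign-extends (λ j _ → ext j) (sym βi)) unassigned
    ...   | _ , assigned   | just y  =
      refutes-label y (<-wellFounded y) M (assign-extends (λ j _ → ext j) (sym βi))
      where
      refutes-label : ∀ y → Acc _<_ y → (M : H ≼ G) → ¬ Extends (MinorModel.β M) (assign p i (just y))
      refutes-label y (acc smaller) M ext with to T-∨ (all-allFin⁻ {f = λ y → redundant p y ∨ refutes is (assign p i (just y))} assigned y)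
      ... | inj₂ r′  = refutes-sound is M ext r′
      ... | inj₁ red =
        let x , x<y , xy , ux , uy = redundant⁻ {p} red
        in refutes-label x (smaller x<y) (swapped xy M) (swapped-extends xy M ux uy ext)

    refutes⇒¬≼ : T (refutes (allFin (size G)) (const nothing)) → ¬ (H ≼ G)
    refutes⇒¬≼ r M = refutes-sound (allFin (size G)) M (λ _ → nothing) r

inSmallPart : Fin 6 → Bool
inSmallPart i = toℕ i ℕ.<ᵇ 2

samePart : Fin 6 → Fin 6 → Bool
samePart a b = ⌊ inSmallPart a Bool.≟ inSmallPart b ⌋

transpose-samePart-preservesAdj : ∀ {a b} → T (samePart a b) → PreservesAdj K24 (PC.transpose a b)
transpose-samePart-preservesAdj {a} {b} ab {h} {k} = toWitness {a? = check} tt a b ab h k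
  where
  check : Dec (∀ a b → T (samePart a b) → ∀ h k → Adj K24 h k → Adj K24 (PC.transpose a b h) (PC.transpose a b k))
  check = all? λ a → all? λ b → T? (samePart a b) →-dec all? λ h → all? λ k →
    Adj? K24 h k →-dec Adj? K24 (PC.transpose a b h) (PC.transpose a b k)

module K24Search (G : Graph) = MinorSearch.Symmetric K24 G samePart transpose-samePart-preservesAdj

K24-free : ∀ G → K24Search.refutes G (allFin (size G)) (const nothing) ≡ true → ¬ (K24 ≼ G)
K24-free G r = K24Search.refutes⇒¬≼ G (from T-≡ r)

corollary2p11 : ¬ (K24 ≼ C) × ¬ (K24 ≼ B⁺) × ¬ (K24 ≼ B) × ¬ (K24 ≼ A⁺) × ¬ (K24 ≼ A) × ¬ (K24 ≼ K33)
corollary2p11 =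
  K24-free C refl , K24-free B⁺ refl , K24-free B refl , K24-free A⁺ refl , K24-free A refl , K24-free K33 refl
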